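{- Let $n=p_1^{n_1}\cdots p_r^{n_r}$ with $r\geq 3$, primes $p_1<\cdots<p_r$ and positive integers $n_i$. Let $a,b\in[r]$ with $a<b$, $s\in[n_a]$ and $t\in[n_b]$. If $p_a^{s-1}\leq p_b^{t-1}$ and $2\phi\left(\frac{p_1\cdots p_r}{p_a}\right)<\frac{p_1\cdots p_r}{p_a}$, then $\beta_a^s>\beta_b^t$.
   Context: $[m]=\{1,\dots,m\}$, $\phi$ is Euler's totient function. For $a\in[r]$ and $s\in[n_a]$, $$\beta_a^s:=\phi(n)+\frac{n}{p_1\cdots p_r}\cdot\frac{1}{p_a^{s-1}}\left[\frac{p_1\cdots p_r}{p_a}+\phi\left(\frac{p_1\cdots p_r}{p_a}\right)(p_a^{s-1}-2)\right].$$ -}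

module Defs where

open import Data.Nat as ℕ using (ℕ; zero; suc; _*_; _∸_; _^_)
open import Data.Nat.GCD using (gcd)
open import Data.Fin using (Fin; _≟_) renaming (zero to fz; suc to fs)
open import Data.List using (List; length; filter; map; upTo)
open import Data.Integer using (+_)
open import Data.Rational as ℚ using (ℚ; _/_)
open import Relation.Nullary using (does)
open import Data.Bool using (if_then_else_)

φ : ℕ → ℕ
φ m = length (filter (λ k → gcd k m ℕ.≟ 1) (map suc (upTo m)))

prodFin : (k : ℕ) → (Fin k → ℕ) → ℕ
prodFin zero    f = 1
prodFin (suc k) f = f fz * prodFin k (λ i → f (fs i))

-- ∏_{i ≠ a} f i  (i.e. (p_1⋯p_r)/p_a when f = p)
prodExcept : (k : ℕ) → (Fin k → ℕ) → Fin k → ℕ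
prodExcept k f a = prodFin k (λ i → if does (i ≟ a) then 1 else f i)

-- the rational number m/d (only used with d ≠ 0; junk value 0 when d = 0)
frac : ℕ → ℕ → ℚ
frac m zero    = ℚ.0ℚ
frac m (suc d) = (+ m) / suc d

ofℕ : ℕ → ℚ
ofℕ m = (+ m) / 1

nOf : (r : ℕ) → (Fin r → ℕ) → (Fin r → ℕ) → ℕ
nOf r p e = prodFin r (λ i → p i ^ e i)

-- β_a^s (s is 1-based, s ∈ [n_a])
β : (r : ℕ) → (p e : Fin r → ℕ) → Fin r → ℕ → ℚ
β r p e a s =
  ofℕ (φ n) ℚ.+
    (frac n P ℚ.* frac 1 q) ℚ.*
      (ofℕ Q ℚ.+ ofℕ (φ Q) ℚ.* (ofℕ q ℚ.- ofℕ 2))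
  where
    n = nOf r p e
    P = prodFin r p
    Q = prodExcept r p a
    q = p a ^ (s ∸ 1)

-- Put R = ∏_{i ≠ a,b} p_i, so that Q_a = p_b R and Q_b = p_a R, and by multiplicativity
-- φ(Q_a) = (p_b − 1) φ(R), φ(Q_b) = (p_a − 1) φ(R).  Up to the common term φ(n) and the
-- positive factor n / (p_1⋯p_r), β_a^s is X_a / q_a with q_a = p_a^{s−1} and
-- X_a = Q_a + φ(Q_a)(q_a − 2).  Writing q_b = q_a + k, a direct computation gives
--   X_a q_b − X_b q_a = k (Q_a − 2 φ(Q_a)) + q_a (p_b − p_a) ((R − φ(R)) + (q_b − 1) φ(R)),
-- where the first term is nonnegative by hypothesis and the second is positive since
-- p_a < p_b and φ(R) < R, the latter because r ≥ 3 forces R ≥ 2.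
module Submission where

open import Defs
open import Data.Bool using (Bool; true; false; _∧_; not; if_then_else_)
open import Data.Bool.Properties using (∧-zeroʳ; ∧-identityʳ)
open import Data.Empty using (⊥-elim)
open import Data.Fin using (Fin; toℕ; _≟_) renaming (zero to fz; suc to fs)
import Data.Fin.Properties as FinP
open import Data.Integer as ℤ using (ℤ; +_; _⊖_)
import Data.Integer.Properties as ℤP
import Data.Integer.Tactic.RingSolver as ℤSolver
open import Data.List using (length; filter; map; applyUpTo)
open import Data.Nat as ℕ using (ℕ; zero; suc; _+_; _*_; _∸_; _^_; _≤_; _<_; s≤s; z≤n)
open import Data.Nat.Coprimality using (Coprime; coprime?; coprime⇒gcd≡1; gcd≡1⇒coprime; coprime-divisor)
open import Data.Nat.Divisibility
  using (_∣_; _∣?_; ∣-refl; ∣-trans; ∣⇒≤; ∣1⇒≡1; ∣m+n∣m⇒∣n; ∣m∣n⇒∣m+n; ∣n⇒∣m*n; m∣m*n)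
open import Data.Nat.GCD using (gcd)
open import Data.Nat.Primality
  using (Prime; euclidsLemma; prime⇒irreducible; prime⇒nonZero; prime⇒nonTrivial)
import Data.Nat.Properties as ℕP
open import Data.Nat.Tactic.RingSolver using (solve-∀)
open import Data.Product using (_,_; _×_; ∃-syntax)
open import Data.Rational as ℚ using (ℚ; toℚᵘ)
import Data.Rational.Properties as ℚP
open import Data.Rational.Unnormalised as ℚᵘ using (mkℚᵘ; *≡*; *<*) renaming (_≃_ to _≃ᵘ_)
import Data.Rational.Unnormalised.Properties as ℚᵘP
open import Data.Sum using (inj₁; inj₂)
open import Function using (_∘_; mk⇔)
open import Function.Definitions using (Injective)
open import Relation.Binary using (tri<; tri≈; tri>)
open import Relation.Binary.PropositionalEquality
open import Relation.Nullary using (¬_; does; yes; no)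
open import Relation.Nullary.Decidable using (does-⇔; dec-true; dec-false)
open import Relation.Unary using (Pred; Decidable)
open import Algebra.Properties.CommutativeSemigroup ℕP.*-commutativeSemigroup using (x∙yz≈y∙xz)

indicator : Bool → ℕ
indicator true  = 1
indicator false = 0

count : (ℕ → Bool) → ℕ → ℕ
count f zero    = 0
count f (suc m) = indicator (f 0) + count (f ∘ suc) m

count-cong : ∀ {f g} m → (∀ i → i < m → f i ≡ g i) → count f m ≡ count g m
count-cong zero    f≗g = refl
count-cong (suc m) f≗g =
  cong₂ _+_ (cong indicator (f≗g 0 (s≤s z≤n))) (count-cong m (λ i i<m → f≗g (suc i) (s≤s i<m)))

count-false : ∀ (f : ℕ → Bool) m → (∀ i → i < m → f i ≡ false) → count f m ≡ 0
count-false f m f≗false = trans (count-cong m f≗false) (count-const-false m)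
  where
  count-const-false : ∀ m → count (λ _ → false) m ≡ 0
  count-const-false zero    = refl
  count-const-false (suc m) = count-const-false m

count-≤ : ∀ (f : ℕ → Bool) m → count f m ≤ m
count-≤ f zero = z≤n
count-≤ f (suc m) with f 0
... | true  = s≤s (count-≤ (f ∘ suc) m)
... | false = ℕP.m≤n⇒m≤1+n (count-≤ (f ∘ suc) m)

count-+ : ∀ (f : ℕ → Bool) m n → count f (m + n) ≡ count f m + count (λ i → f (m + i)) n
count-+ f zero    n = refl
count-+ f (suc m) n =
  trans (cong (_+_ (indicator (f 0))) (count-+ (f ∘ suc) m n)) (sym (ℕP.+-assoc (indicator (f 0)) _ _))

count-split : ∀ (f g : ℕ → Bool) m → count (λ i → f i ∧ not (g i)) m + count (λ i → f i ∧ g i) m ≡ count f m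
count-split f g zero = refl
count-split f g (suc m) with f 0 | g 0
... | false | _     = count-split (f ∘ suc) (g ∘ suc) m
... | true  | false = cong suc (count-split (f ∘ suc) (g ∘ suc) m)
... | true  | true  = trans (ℕP.+-suc _ _) (cong suc (count-split (f ∘ suc) (g ∘ suc) m))

count-periodic : ∀ (f : ℕ → Bool) R → (∀ i → f (R + i) ≡ f i) → ∀ c → count f (c * R) ≡ c * count f R
count-periodic f R periodic zero    = refl
count-periodic f R periodic (suc c) = begin
  count f (R + c * R)                       ≡⟨ count-+ f R (c * R) ⟩
  count f R + count (λ i → f (R + i)) (c * R) ≡⟨ cong (_+_ (count f R)) (count-cong (c * R) (λ i _ → periodic i)) ⟩
  count f R + count f (c * R)               ≡⟨ cong (_+_ (count f R)) (count-periodic f R periodic c) ⟩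
  count f R + c * count f R                 ∎
  where open ≡-Reasoning

divisibleBy : ℕ → ℕ → Bool
divisibleBy p k = does (p ∣? k)

divisibleBy-+ : ∀ p k → divisibleBy p (p + k) ≡ divisibleBy p k
divisibleBy-+ p k = does-⇔ (mk⇔ (λ p∣p+k → ∣m+n∣m⇒∣n p∣p+k ∣-refl) (∣m∣n⇒∣m+n ∣-refl)) (p ∣? (p + k)) (p ∣? k)

divisibleBy-small : ∀ p k → 0 < k → k < p → divisibleBy p k ≡ false
divisibleBy-small p k 0<k k<p = dec-false (p ∣? k) (λ p∣k → ℕP.<⇒≱ k<p (∣⇒≤ ⦃ ℕ.>-nonZero 0<k ⦄ p∣k))

count-multiples-block : ∀ p′ (x : ℕ → Bool) →
  count (λ i → x (suc i) ∧ divisibleBy (suc p′) (suc i)) (suc p′) ≡ indicator (x (suc p′ * 1))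
count-multiples-block p′ x = begin
  count h (suc p′)                       ≡⟨ cong (count h) (ℕP.+-comm 1 p′) ⟩
  count h (p′ + 1)                       ≡⟨ count-+ h p′ 1 ⟩
  count h p′ + (indicator (h (p′ + 0)) + 0) ≡⟨ cong₂ _+_ (count-false h p′ (λ i i<p′ → below i i<p′)) (ℕP.+-identityʳ _) ⟩
  indicator (h (p′ + 0))                 ≡⟨ cong (indicator ∘ h) (ℕP.+-identityʳ p′) ⟩
  indicator (x p ∧ divisibleBy p p)      ≡⟨ cong (λ d → indicator (x p ∧ d)) (dec-true (p ∣? p) ∣-refl) ⟩
  indicator (x p ∧ true)                 ≡⟨ cong indicator (trans (∧-identityʳ (x p)) (cong x (sym (ℕP.*-identityʳ p)))) ⟩
  indicator (x (p * 1))                  ∎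
  where
  open ≡-Reasoning
  p = suc p′
  h = λ i → x (suc i) ∧ divisibleBy p (suc i)
  below : ∀ i → i < p′ → h i ≡ false
  below i i<p′ = trans (cong (x (suc i) ∧_) (divisibleBy-small p (suc i) (s≤s z≤n) (s≤s i<p′))) (∧-zeroʳ _)

count-multiples : ∀ p′ (x : ℕ → Bool) c →
  count (λ i → x (suc i) ∧ divisibleBy (suc p′) (suc i)) (c * suc p′) ≡ count (λ j → x (suc p′ * suc j)) c
count-multiples p′ x zero    = refl
count-multiples p′ x (suc c) = begin
  count h (p + c * p)                             ≡⟨ count-+ h p (c * p) ⟩
  count h p + count (λ i → h (p + i)) (c * p)     ≡⟨ cong₂ _+_ (count-multiples-block p′ x) (count-cong (c * p) shifted) ⟩
  indicator (x (p * 1)) + count h′ (c * p)        ≡⟨ cong (_+_ (indicator (x (p * 1)))) (count-multiples p′ (λ k → x (p + k)) c) ⟩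
  indicator (x (p * 1)) + count (λ j → x (p + p * suc j)) c
    ≡⟨ cong (_+_ (indicator (x (p * 1)))) (count-cong c (λ j _ → cong x (sym (ℕP.*-suc p (suc j))))) ⟩
  indicator (x (p * 1)) + count (λ j → x (p * suc (suc j))) c ∎
  where
  open ≡-Reasoning
  p = suc p′
  h = λ i → x (suc i) ∧ divisibleBy p (suc i)
  h′ = λ i → x (p + suc i) ∧ divisibleBy p (suc i)
  shifted : ∀ i → i < c * p → h (p + i) ≡ h′ i
  shifted i _ = cong₂ _∧_ (cong x (sym (ℕP.+-suc p i)))
                  (trans (cong (divisibleBy p) (sym (ℕP.+-suc p i))) (divisibleBy-+ p (suc i)))

length-filter-map-suc : ∀ {ℓ} {P : Pred ℕ ℓ} (P? : Decidable P) h m →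
  length (filter P? (map suc (applyUpTo h m))) ≡ count (λ i → does (P? (suc (h i)))) m
length-filter-map-suc P? h zero = refl
length-filter-map-suc P? h (suc m) with does (P? (suc (h 0)))
... | true  = cong suc (length-filter-map-suc P? (h ∘ suc) m)
... | false = length-filter-map-suc P? (h ∘ suc) m

coprimeTo : ℕ → ℕ → Bool
coprimeTo n k = does (coprime? k n)

φ≡count : ∀ n → φ n ≡ count (λ i → coprimeTo n (suc i)) n
φ≡count n = trans (length-filter-map-suc (λ k → gcd k n ℕ.≟ 1) (λ i → i) n)
  (count-cong n (λ i _ → does-⇔ (mk⇔ gcd≡1⇒coprime coprime⇒gcd≡1) (gcd (suc i) n ℕ.≟ 1) (coprime? (suc i) n)))

coprimeTo-+ : ∀ n k → coprimeTo n (n + k) ≡ coprimeTo n k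
coprimeTo-+ n k = does-⇔ (mk⇔ forth back) (coprime? (n + k) n) (coprime? k n)
  where
  forth : Coprime (n + k) n → Coprime k n
  forth cop (d∣k , d∣n) = cop (∣m∣n⇒∣m+n d∣n d∣k , d∣n)
  back : Coprime k n → Coprime (n + k) n
  back cop (d∣n+k , d∣n) = cop (∣m+n∣m⇒∣n d∣n+k d∣n , d∣n)

prime⇒≢1 : ∀ {p} → Prime p → p ≢ 1
prime⇒≢1 pp = ℕ.nonTrivial⇒≢1 ⦃ prime⇒nonTrivial pp ⦄

divisor-coprime : ∀ {p n d} → Prime p → ¬ p ∣ n → d ∣ n → Coprime d p
divisor-coprime pp p∤n d∣n (e∣d , e∣p) with prime⇒irreducible pp e∣p
... | inj₁ e≡1 = e≡1
... | inj₂ refl = ⊥-elim (p∤n (∣-trans e∣d d∣n))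

coprimeTo-*-prime : ∀ {p} n k → Prime p → ¬ p ∣ n → coprimeTo n (p * k) ≡ coprimeTo n k
coprimeTo-*-prime {p} n k pp p∤n = does-⇔ (mk⇔ forth back) (coprime? (p * k) n) (coprime? k n)
  where
  forth : Coprime (p * k) n → Coprime k n
  forth cop (d∣k , d∣n) = cop (∣n⇒∣m*n p d∣k , d∣n)
  back : Coprime k n → Coprime (p * k) n
  back cop (d∣pk , d∣n) = cop (coprime-divisor (divisor-coprime pp p∤n d∣n) d∣pk , d∣n)

coprimeTo-prime-* : ∀ {p} n k → Prime p → coprimeTo (p * n) k ≡ coprimeTo n k ∧ not (divisibleBy p k)
coprimeTo-prime-* {p} n k pp with p ∣? k
... | yes p∣k = trans (dec-false (coprime? k (p * n)) (λ cop → prime⇒≢1 pp (cop (p∣k , m∣m*n n))))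
                      (sym (∧-zeroʳ _))
... | no p∤k  = trans (does-⇔ (mk⇔ forth back) (coprime? k (p * n)) (coprime? k n)) (sym (∧-identityʳ _))
  where
  forth : Coprime k (p * n) → Coprime k n
  forth cop (d∣k , d∣n) = cop (d∣k , ∣n⇒∣m*n p d∣n)
  back : Coprime k n → Coprime k (p * n)
  back cop (d∣k , d∣pn) = cop (d∣k , coprime-divisor (divisor-coprime pp p∤k d∣k) d∣pn)

φ-*-prime : ∀ {p} n → Prime p → ¬ p ∣ n → φ (p * n) ≡ (p ∸ 1) * φ n
φ-*-prime {zero} n pp p∤n = ⊥-elim (ℕ.≢-nonZero⁻¹ 0 ⦃ prime⇒nonZero pp ⦄ refl)
φ-*-prime {suc p′} n pp p∤n = ℕP.+-cancelʳ-≡ (φ n) (φ (p * n)) (p′ * φ n) (begin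
  φ (p * n) + φ n                                      ≡⟨ cong₂ _+_ coprime-nondivisible (sym coprime-divisible) ⟩
  count (λ i → c i ∧ not (d i)) (p * n) + count (λ i → c i ∧ d i) (p * n) ≡⟨ count-split c d (p * n) ⟩
  count c (p * n)                                      ≡⟨ count-periodic c n c-periodic p ⟩
  p * count c n                                        ≡⟨ cong (p *_) (sym (φ≡count n)) ⟩
  φ n + p′ * φ n                                       ≡⟨ ℕP.+-comm (φ n) (p′ * φ n) ⟩
  p′ * φ n + φ n                                       ∎)
  where
  open ≡-Reasoning
  p = suc p′
  c = λ i → coprimeTo n (suc i)
  d = λ i → divisibleBy p (suc i)
  c-periodic : ∀ i → c (n + i) ≡ c i
  c-periodic i = trans (cong (coprimeTo n) (sym (ℕP.+-suc n i))) (coprimeTo-+ n (suc i))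
  coprime-nondivisible : φ (p * n) ≡ count (λ i → c i ∧ not (d i)) (p * n)
  coprime-nondivisible = trans (φ≡count (p * n)) (count-cong (p * n) (λ i _ → coprimeTo-prime-* n (suc i) pp))
  -- the multiples of p in [1, p n] are p j with j ∈ [1, n], and p j is coprime to n iff j is
  coprime-divisible : count (λ i → c i ∧ d i) (p * n) ≡ φ n
  coprime-divisible = begin
    count (λ i → c i ∧ d i) (p * n)    ≡⟨ cong (count (λ i → c i ∧ d i)) (ℕP.*-comm p n) ⟩
    count (λ i → c i ∧ d i) (n * p)    ≡⟨ count-multiples p′ (coprimeTo n) n ⟩
    count (λ j → coprimeTo n (p * suc j)) n ≡⟨ count-cong n (λ j _ → coprimeTo-*-prime n (suc j) pp p∤n) ⟩
    count c n                          ≡⟨ sym (φ≡count n) ⟩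
    φ n                                ∎

φ<n : ∀ n → 2 ≤ n → φ n < n
φ<n (suc n′) 2≤n = subst (_< n) (sym φ≡count-below-n) (s≤s (count-≤ c n′))
  where
  open ≡-Reasoning
  n = suc n′
  c = λ i → coprimeTo n (suc i)
  n-not-coprime : coprimeTo n n ≡ false
  n-not-coprime = dec-false (coprime? n n) (λ cop → ℕP.<⇒≢ 2≤n (sym (cop (∣-refl , ∣-refl))))
  φ≡count-below-n : φ n ≡ count c n′
  φ≡count-below-n = begin
    φ n                                          ≡⟨ φ≡count n ⟩
    count c n                                    ≡⟨ cong (count c) (ℕP.+-comm 1 n′) ⟩
    count c (n′ + 1)                             ≡⟨ count-+ c n′ 1 ⟩
    count c n′ + (indicator (c (n′ + 0)) + 0)    ≡⟨ cong (λ m → count c n′ + (indicator (coprimeTo n (suc m)) + 0)) (ℕP.+-identityʳ n′) ⟩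
    count c n′ + (indicator (coprimeTo n n) + 0) ≡⟨ cong (λ b → count c n′ + (indicator b + 0)) n-not-coprime ⟩
    count c n′ + 0                               ≡⟨ ℕP.+-identityʳ _ ⟩
    count c n′                                   ∎

prodFin-cong : ∀ k {f g : Fin k → ℕ} → (∀ i → f i ≡ g i) → prodFin k f ≡ prodFin k g
prodFin-cong zero    f≗g = refl
prodFin-cong (suc k) f≗g = cong₂ _*_ (f≗g fz) (prodFin-cong k (f≗g ∘ fs))

prodFin-pos : ∀ k (f : Fin k → ℕ) → (∀ i → 0 < f i) → 0 < prodFin k f
prodFin-pos zero    f f>0 = s≤s z≤n
prodFin-pos (suc k) f f>0 = ℕP.*-mono-≤ (f>0 fz) (prodFin-pos k (f ∘ fs) (f>0 ∘ fs))

prime∤prodFin : ∀ k (f : Fin k → ℕ) {q} → Prime q → (∀ i → ¬ q ∣ f i) → ¬ q ∣ prodFin k f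
prime∤prodFin zero    f qp q∤f q∣1 = prime⇒≢1 qp (∣1⇒≡1 q∣1)
prime∤prodFin (suc k) f qp q∤f q∣prod with euclidsLemma (f fz) (prodFin k (f ∘ fs)) qp q∣prod
... | inj₁ q∣head = q∤f fz q∣head
... | inj₂ q∣tail = prime∤prodFin k (f ∘ fs) qp (q∤f ∘ fs) q∣tail

except : ∀ {k} → (Fin k → ℕ) → Fin k → Fin k → ℕ
except f c i = if does (i ≟ c) then 1 else f i

except-≢ : ∀ {k} (f : Fin k → ℕ) {c i} → i ≢ c → except f c i ≡ f i
except-≢ f {c} {i} i≢c with i ≟ c
... | yes i≡c = ⊥-elim (i≢c i≡c)
... | no _    = refl

except-elim : ∀ {k} (P : ℕ → Set) (f : Fin k → ℕ) c {i} → P 1 → (i ≢ c → P (f i)) → P (except f c i)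
except-elim P f c {i} P1 Pf with i ≟ c
... | yes _   = P1
... | no i≢c  = Pf i≢c

except-pos : ∀ {k} {f : Fin k → ℕ} → (∀ i → 0 < f i) → ∀ c i → 0 < except f c i
except-pos {f = f} f>0 c i = except-elim (0 <_) f c {i} (s≤s z≤n) (λ _ → f>0 i)

except-comm : ∀ {k} (f : Fin k → ℕ) a b i → except (except f a) b i ≡ except (except f b) a i
except-comm f a b i with does (i ≟ a) | does (i ≟ b)
... | true  | true  = refl
... | true  | false = refl
... | false | true  = refl
... | false | false = refl

prodFin-except : ∀ k (f : Fin k → ℕ) c → prodFin k f ≡ f c * prodExcept k f c
prodFin-except (suc k) f fz     = cong (f fz *_) (sym (ℕP.*-identityˡ _))
prodFin-except (suc k) f (fs c) = begin
  f fz * prodFin k (f ∘ fs)                                  ≡⟨ cong (f fz *_) (prodFin-except k (f ∘ fs) c) ⟩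
  f fz * (f (fs c) * prodExcept k (f ∘ fs) c)                ≡⟨ x∙yz≈y∙xz (f fz) (f (fs c)) _ ⟩
  f (fs c) * (f fz * prodExcept k (f ∘ fs) c)                ∎
  where open ≡-Reasoning

third-index : ∀ {r} → 3 ≤ r → (a b : Fin r) → ∃[ c ] (c ≢ a × c ≢ b)
third-index (s≤s (s≤s (s≤s _))) fz            fz            = fs fz , (λ ()) , (λ ())
third-index (s≤s (s≤s (s≤s _))) fz            (fs fz)       = fs (fs fz) , (λ ()) , (λ ())
third-index (s≤s (s≤s (s≤s _))) fz            (fs (fs _))   = fs fz , (λ ()) , (λ ())
third-index (s≤s (s≤s (s≤s _))) (fs fz)       fz            = fs (fs fz) , (λ ()) , (λ ())
third-index (s≤s (s≤s (s≤s _))) (fs (fs _))   fz            = fs fz , (λ ()) , (λ ())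
third-index (s≤s (s≤s (s≤s _))) (fs _)        (fs _)        = fz , (λ ()) , (λ ())

prodExcept-split : ∀ r (f : Fin r → ℕ) {a b} → b ≢ a → prodExcept r f a ≡ f b * prodExcept r (except f a) b
prodExcept-split r f {a} {b} b≢a =
  trans (prodFin-except r (except f a) b) (cong (_* prodExcept r (except f a) b) (except-≢ f b≢a))

prodExcept-swap : ∀ r (f : Fin r → ℕ) a b → prodExcept r (except f a) b ≡ prodExcept r (except f b) a
prodExcept-swap r f a b = prodFin-cong r (except-comm f a b)

module DistinctPrimes {r} (p : Fin r → ℕ) (prime : ∀ i → Prime (p i)) where

  prime∤prodExcept₂ : Injective _≡_ _≡_ p → ∀ {a b x} → (∀ {i} → i ≢ a → i ≢ b → i ≢ x) →
    ¬ p x ∣ prodExcept r (except p a) b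
  prime∤prodExcept₂ injective {a} {b} {x} x∈ab =
    prime∤prodFin r (except (except p a) b) (prime x) (λ i →
      except-elim P (except p a) b {i} prime∤1 (λ i≢b → except-elim P p a {i} prime∤1 (λ i≢a → prime∤other (x∈ab i≢a i≢b))))
    where
    P = λ m → ¬ p x ∣ m
    prime∤1 : ¬ p x ∣ 1
    prime∤1 px∣1 = prime⇒≢1 (prime x) (∣1⇒≡1 px∣1)
    prime∤other : ∀ {i} → i ≢ x → ¬ p x ∣ p i
    prime∤other {i} i≢x px∣pi with prime⇒irreducible (prime i) px∣pi
    ... | inj₁ px≡1  = prime⇒≢1 (prime x) px≡1
    ... | inj₂ px≡pi = i≢x (sym (injective px≡pi))

  prime>0 : ∀ i → 0 < p i
  prime>0 i = ℕP.<⇒≤ (ℕ.nonTrivial⇒n>1 (p i) ⦃ prime⇒nonTrivial (prime i) ⦄)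

  2≤prodExcept₂ : 3 ≤ r → ∀ a b → 2 ≤ prodExcept r (except p a) b
  2≤prodExcept₂ r≥3 a b with third-index r≥3 a b
  ... | c , c≢a , c≢b = subst (2 ≤_) (sym (prodFin-except r g c))
    (ℕP.*-mono-≤ (subst (2 ≤_) (sym g[c]≡p[c]) (ℕ.nonTrivial⇒n>1 (p c) ⦃ prime⇒nonTrivial (prime c) ⦄))
                 (prodFin-pos r (except g c) (except-pos (except-pos (except-pos prime>0 a) b) c)))
    where
    g = except (except p a) b
    g[c]≡p[c] : g c ≡ p c
    g[c]≡p[c] = trans (except-≢ (except p a) c≢b) (except-≢ p c≢a)

strictMono⇒injective : ∀ {r} (f : Fin r → ℕ) → (∀ i j → toℕ i < toℕ j → f i < f j) → Injective _≡_ _≡_ f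
strictMono⇒injective f increasing {i} {j} fi≡fj with ℕP.<-cmp (toℕ i) (toℕ j)
... | tri< i<j _ _ = ⊥-elim (ℕP.<⇒≢ (increasing i j i<j) fi≡fj)
... | tri≈ _ i≡j _ = FinP.toℕ-injective i≡j
... | tri> _ _ j<i = ⊥-elim (ℕP.<⇒≢ (increasing j i j<i) (sym fi≡fj))

bracket-ratio-< : ∀ {R f pa pb qa qb Qa Qb φa φb} →
  Qa ≡ pb * R → Qb ≡ pa * R → φa ≡ (pb ∸ 1) * f → φb ≡ (pa ∸ 1) * f →
  f < R → 0 < pa → pa < pb → 0 < qa → qa ≤ qb → 2 * φa < Qa →
  (Qb + φb * qb) * qa + 2 * φa * qb < (Qa + φa * qa) * qb + 2 * φb * qa
bracket-ratio-< {f = f} {pa = suc a} {qa = suc u} refl refl refl refl f<R _ pa<pb _ qa≤qb 2φa<Qa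
  with ℕP.m≤n⇒∃[o]m+o≡n f<R | ℕP.m≤n⇒∃[o]m+o≡n pa<pb | ℕP.m≤n⇒∃[o]m+o≡n qa≤qb
... | g , refl | d , refl | k , refl =
  ℕP.+-cancelʳ-< (k * (2 * φa)) lhs rhs
    (subst (lhs + k * (2 * φa) <_) (sym (difference f g a d u k))
      (ℕP.≤-<-trans (ℕP.+-monoʳ-≤ lhs (ℕP.*-monoʳ-≤ k (ℕP.<⇒≤ 2φa<Qa))) (ℕP.m<m+n (lhs + k * Qa) (s≤s z≤n))))
  where
  R = suc f + g ; pa = suc a ; pb = suc (suc a) + d ; qa = suc u ; qb = suc u + k
  Qa = pb * R ; Qb = pa * R ; φa = (pb ∸ 1) * f ; φb = (pa ∸ 1) * f
  lhs = (Qb + φb * qb) * qa + 2 * φa * qb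
  rhs = (Qa + φa * qa) * qb + 2 * φb * qa
  difference : ∀ f g a d u k →
    let R = suc f + g ; pa = suc a ; pb = suc (suc a) + d ; qa = suc u ; qb = suc u + k
        Qa = pb * R ; Qb = pa * R ; φa = (suc a + d) * f ; φb = a * f
    in (Qa + φa * qa) * qb + 2 * φb * qa + k * (2 * φa)
       ≡ (Qb + φb * qb) * qa + 2 * φa * qb + k * Qa + qa * suc d * (suc g + (u + k) * f)
  difference = solve-∀

-- β r p e a s unfolds definitionally to βExpr (φ n) n (p_1⋯p_r) (p_a^{s−1}) Q_a (φ Q_a).
βExpr : ℕ → ℕ → ℕ → ℕ → ℕ → ℕ → ℚ
βExpr N n P q Q φQ = ofℕ N ℚ.+ (frac n P ℚ.* frac 1 q) ℚ.* (ofℕ Q ℚ.+ ofℕ φQ ℚ.* (ofℕ q ℚ.- ofℕ 2))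

bracket : ℕ → ℕ → ℕ → ℤ
bracket q Q φQ = + Q ℤ.+ + φQ ℤ.* (+ q ℤ.- + 2)

toℚᵘ-frac : ∀ m d → toℚᵘ (frac m (suc d)) ≃ᵘ mkℚᵘ (+ m) d
toℚᵘ-frac m d = ℚP.toℚᵘ-fromℚᵘ (mkℚᵘ (+ m) d)

toℚᵘ-bracket : ∀ q Q φQ → toℚᵘ (ofℕ Q ℚ.+ ofℕ φQ ℚ.* (ofℕ q ℚ.- ofℕ 2)) ≃ᵘ mkℚᵘ (bracket q Q φQ) 0
toℚᵘ-bracket q Q φQ = begin
  toℚᵘ (ofℕ Q ℚ.+ ofℕ φQ ℚ.* (ofℕ q ℚ.- ofℕ 2))
    ≈⟨ ℚP.toℚᵘ-homo-+ (ofℕ Q) _ ⟩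
  toℚᵘ (ofℕ Q) ℚᵘ.+ toℚᵘ (ofℕ φQ ℚ.* (ofℕ q ℚ.- ofℕ 2))
    ≈⟨ ℚᵘP.+-congʳ (toℚᵘ (ofℕ Q)) (ℚP.toℚᵘ-homo-* (ofℕ φQ) _) ⟩
  toℚᵘ (ofℕ Q) ℚᵘ.+ toℚᵘ (ofℕ φQ) ℚᵘ.* toℚᵘ (ofℕ q ℚ.- ofℕ 2)
    ≈⟨ ℚᵘP.+-congʳ (toℚᵘ (ofℕ Q)) (ℚᵘP.*-congˡ {toℚᵘ (ofℕ φQ)}
         (ℚᵘP.≃-trans (ℚP.toℚᵘ-homo-+ (ofℕ q) _) (ℚᵘP.+-congʳ (toℚᵘ (ofℕ q)) (ℚP.toℚᵘ-homo‿- (ofℕ 2))))) ⟩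
  toℚᵘ (ofℕ Q) ℚᵘ.+ toℚᵘ (ofℕ φQ) ℚᵘ.* (toℚᵘ (ofℕ q) ℚᵘ.- toℚᵘ (ofℕ 2))
    ≈⟨ ℚᵘP.+-cong (toℚᵘ-frac Q 0) (ℚᵘP.*-cong (toℚᵘ-frac φQ 0) (ℚᵘP.+-cong (toℚᵘ-frac q 0) (ℚᵘP.-‿cong (toℚᵘ-frac 2 0)))) ⟩
  mkℚᵘ (+ Q) 0 ℚᵘ.+ mkℚᵘ (+ φQ) 0 ℚᵘ.* (mkℚᵘ (+ q) 0 ℚᵘ.- mkℚᵘ (+ 2) 0)
    ≈⟨ *≡* (clear-denominators (+ Q) (+ φQ) (+ q) (+ 2)) ⟩
  mkℚᵘ (bracket q Q φQ) 0 ∎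
  where
  open ℚᵘP.≃-Reasoning
  clear-denominators : ∀ Q φQ q t → (Q ℤ.* + 1 ℤ.+ (φQ ℤ.* (q ℤ.* + 1 ℤ.+ (ℤ.- t) ℤ.* + 1)) ℤ.* + 1) ℤ.* + 1
                         ≡ (Q ℤ.+ φQ ℤ.* (q ℤ.- t)) ℤ.* + 1
  clear-denominators = ℤSolver.solve-∀

1/[1+d]*z≃z/[1+d] : ∀ d z → mkℚᵘ (+ 1) d ℚᵘ.* mkℚᵘ z 0 ≃ᵘ mkℚᵘ z d
1/[1+d]*z≃z/[1+d] d z = *≡* (subst (λ e → (+ 1 ℤ.* z) ℤ.* + suc d ≡ z ℤ.* + suc e)
  (sym (ℕP.*-identityʳ d)) (cong (ℤ._* + suc d) (ℤP.*-identityˡ z)))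

toℚᵘ-βExpr : ∀ N n P′ q′ Q φQ →
  toℚᵘ (βExpr N n (suc P′) (suc q′) Q φQ) ≃ᵘ mkℚᵘ (+ N) 0 ℚᵘ.+ mkℚᵘ (+ n) P′ ℚᵘ.* mkℚᵘ (bracket (suc q′) Q φQ) q′
toℚᵘ-βExpr N n P′ q′ Q φQ = begin
  toℚᵘ (ofℕ N ℚ.+ scale ℚ.* B)                  ≈⟨ ℚP.toℚᵘ-homo-+ (ofℕ N) _ ⟩
  toℚᵘ (ofℕ N) ℚᵘ.+ toℚᵘ (scale ℚ.* B)          ≈⟨ ℚᵘP.+-cong (toℚᵘ-frac N 0) (ℚᵘP.≃-trans (ℚP.toℚᵘ-homo-* scale B)
                                                     (ℚᵘP.*-cong toℚᵘ-scale (toℚᵘ-bracket (suc q′) Q φQ))) ⟩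
  mkℚᵘ (+ N) 0 ℚᵘ.+ (n/P ℚᵘ.* 1/q) ℚᵘ.* X       ≈⟨ ℚᵘP.+-congʳ (mkℚᵘ (+ N) 0) (ℚᵘP.*-assoc n/P 1/q X) ⟩
  mkℚᵘ (+ N) 0 ℚᵘ.+ n/P ℚᵘ.* (1/q ℚᵘ.* X)       ≈⟨ ℚᵘP.+-congʳ (mkℚᵘ (+ N) 0) (ℚᵘP.*-congˡ {n/P} (1/[1+d]*z≃z/[1+d] q′ _)) ⟩
  mkℚᵘ (+ N) 0 ℚᵘ.+ n/P ℚᵘ.* mkℚᵘ (bracket (suc q′) Q φQ) q′ ∎
  where
  open ℚᵘP.≃-Reasoning
  scale = frac n (suc P′) ℚ.* frac 1 (suc q′)
  B = ofℕ Q ℚ.+ ofℕ φQ ℚ.* (ofℕ (suc q′) ℚ.- ofℕ 2)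
  n/P = mkℚᵘ (+ n) P′
  1/q = mkℚᵘ (+ 1) q′
  X = mkℚᵘ (bracket (suc q′) Q φQ) 0
  toℚᵘ-scale : toℚᵘ scale ≃ᵘ n/P ℚᵘ.* 1/q
  toℚᵘ-scale = ℚᵘP.≃-trans (ℚP.toℚᵘ-homo-* (frac n (suc P′)) (frac 1 (suc q′)))
                            (ℚᵘP.*-cong (toℚᵘ-frac n P′) (toℚᵘ-frac 1 q′))

bracket-* : ∀ q Q φQ q′ → bracket q Q φQ ℤ.* + q′ ≡ (Q + φQ * q) * q′ ⊖ 2 * φQ * q′
bracket-* q Q φQ q′ = begin
  (+ Q ℤ.+ + φQ ℤ.* (+ q ℤ.- + 2)) ℤ.* + q′           ≡⟨ expand (+ Q) (+ φQ) (+ q) (+ q′) (+ 2) ⟩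
  (+ Q ℤ.+ + φQ ℤ.* + q) ℤ.* + q′ ℤ.- + 2 ℤ.* + φQ ℤ.* + q′ ≡⟨ cong₂ ℤ._-_ (sym positive-part) (sym negative-part) ⟩
  + ((Q + φQ * q) * q′) ℤ.- + (2 * φQ * q′)           ≡⟨ ℤP.[+m]-[+n]≡m⊖n ((Q + φQ * q) * q′) (2 * φQ * q′) ⟩
  (Q + φQ * q) * q′ ⊖ 2 * φQ * q′                     ∎
  where
  open ≡-Reasoning
  expand : ∀ Q φQ q q′ t → (Q ℤ.+ φQ ℤ.* (q ℤ.- t)) ℤ.* q′ ≡ (Q ℤ.+ φQ ℤ.* q) ℤ.* q′ ℤ.- t ℤ.* φQ ℤ.* q′
  expand = ℤSolver.solve-∀
  positive-part : + ((Q + φQ * q) * q′) ≡ (+ Q ℤ.+ + φQ ℤ.* + q) ℤ.* + q′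
  positive-part = trans (ℤP.pos-* (Q + φQ * q) q′)
    (cong (ℤ._* + q′) (trans (ℤP.pos-+ Q (φQ * q)) (cong (ℤ._+_ (+ Q)) (ℤP.pos-* φQ q))))
  negative-part : + (2 * φQ * q′) ≡ + 2 ℤ.* + φQ ℤ.* + q′
  negative-part = trans (ℤP.pos-* (2 * φQ) q′) (cong (ℤ._* + q′) (ℤP.pos-* 2 φQ))

m+p<o+n⇒m⊖n<o⊖p : ∀ {m n o p} → m + p < o + n → m ⊖ n ℤ.< o ⊖ p
m+p<o+n⇒m⊖n<o⊖p {m} {n} {o} {p} m+p<o+n = begin-strict
  m ⊖ n             ≡⟨ ℤP.+-cancelˡ-⊖ p m n ⟨
  (p + m) ⊖ (p + n) ≡⟨ cong₂ _⊖_ (ℕP.+-comm p m) (ℕP.+-comm p n) ⟩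
  (m + p) ⊖ (n + p) <⟨ ℤP.⊖-monoˡ-< (n + p) m+p<o+n ⟩
  (o + n) ⊖ (n + p) ≡⟨ cong (_⊖ (n + p)) (ℕP.+-comm o n) ⟩
  (n + o) ⊖ (n + p) ≡⟨ ℤP.+-cancelˡ-⊖ n o p ⟩
  o ⊖ p             ∎
  where open ℤP.≤-Reasoning

βExpr-< : ∀ {N n P qa qb Qa Qb φa φb} → 0 < n → 0 < P → 0 < qa → 0 < qb →
  (Qb + φb * qb) * qa + 2 * φa * qb < (Qa + φa * qa) * qb + 2 * φb * qa →
  βExpr N n P qb Qb φb ℚ.< βExpr N n P qa Qa φa
βExpr-< {N} {suc n′} {suc P′} {suc qa′} {suc qb′} {Qa} {Qb} {φa} {φb} _ _ _ _ cross =
  ℚP.toℚᵘ-cancel-< (ℚᵘP.<-respˡ-≃ (ℚᵘP.≃-sym (toℚᵘ-βExpr N (suc n′) P′ qb′ Qb φb))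
    (ℚᵘP.<-respʳ-≃ (ℚᵘP.≃-sym (toℚᵘ-βExpr N (suc n′) P′ qa′ Qa φa))
      (ℚᵘP.+-monoʳ-< (mkℚᵘ (+ N) 0) (ℚᵘP.*-monoʳ-<-pos (mkℚᵘ (+ suc n′) P′)
        (*<* {mkℚᵘ (bracket (suc qb′) Qb φb) qb′} {mkℚᵘ (bracket (suc qa′) Qa φa) qa′} bracket-cross)))))
  where
  bracket-cross : bracket (suc qb′) Qb φb ℤ.* + suc qa′ ℤ.< bracket (suc qa′) Qa φa ℤ.* + suc qb′
  bracket-cross = subst₂ ℤ._<_ (sym (bracket-* (suc qb′) Qb φb (suc qa′))) (sym (bracket-* (suc qa′) Qa φa (suc qb′)))
    (m+p<o+n⇒m⊖n<o⊖p {(Qb + φb * suc qb′) * suc qa′} {2 * φb * suc qa′} cross)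

lemma3p5 : (r : ℕ) → 3 ≤ r
    → (p e : Fin r → ℕ)
    → (∀ i → Prime (p i))
    → (∀ i j → toℕ i < toℕ j → p i < p j)
    → (∀ i → 1 ≤ e i)
    → (a b : Fin r) → toℕ a < toℕ b
    → (s t : ℕ) → 1 ≤ s → s ≤ e a → 1 ≤ t → t ≤ e b
    → p a ^ (s ∸ 1) ≤ p b ^ (t ∸ 1)
    → 2 * φ (prodExcept r p a) < prodExcept r p a
    → β r p e b t ℚ.< β r p e a s
lemma3p5 r r≥3 p e prime increasing _ a b a<b s t _ _ _ _ qa≤qb 2φQa<Qa =
  βExpr-< {N = φ (nOf r p e)} {Qa = prodExcept r p a} {Qb = prodExcept r p b}
    {φa = φ (prodExcept r p a)} {φb = φ (prodExcept r p b)}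
    (prodFin-pos r (λ i → p i ^ e i) (λ i → p^k>0 i (e i))) (prodFin-pos r p prime>0)
    (p^k>0 a (s ∸ 1)) (p^k>0 b (t ∸ 1))
    (bracket-ratio-< Qa≡pb*R Qb≡pa*R (φ-remove b Qa≡pb*R (λ _ i≢b → i≢b)) (φ-remove a Qb≡pa*R (λ i≢a _ → i≢a))
      (φ<n R (2≤prodExcept₂ r≥3 a b)) (prime>0 a) (increasing a b a<b) (p^k>0 a (s ∸ 1)) qa≤qb 2φQa<Qa)
  where
  open DistinctPrimes p prime
  R = prodExcept r (except p a) b
  p^k>0 : ∀ i k → 0 < p i ^ k
  p^k>0 i = ℕP.m^n>0 (p i) ⦃ prime⇒nonZero (prime i) ⦄
  b≢a : b ≢ a
  b≢a b≡a = ℕP.<⇒≢ a<b (cong toℕ (sym b≡a))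
  Qa≡pb*R : prodExcept r p a ≡ p b * R
  Qa≡pb*R = prodExcept-split r p b≢a
  Qb≡pa*R : prodExcept r p b ≡ p a * R
  Qb≡pa*R = trans (prodExcept-split r p (b≢a ∘ sym)) (cong (p a *_) (prodExcept-swap r p b a))
  φ-remove : ∀ {Q} x → Q ≡ p x * R → (∀ {i} → i ≢ a → i ≢ b → i ≢ x) → φ Q ≡ (p x ∸ 1) * φ R
  φ-remove x Q≡px*R x∈ab = trans (cong φ Q≡px*R)
    (φ-*-prime R (prime x) (prime∤prodExcept₂ (strictMono⇒injective p increasing) x∈ab))
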